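{- Let $\Delta$ be a $(d-1)$-dimensional balanced simplicial complex with coloring map $\kappa:V(\Delta)\to[d]$, and let $S\subseteq[d]$ with complement $S^c=[d]\setminus S$. Then \[ h_S(\Delta)-h_{S^c}(\Delta)=(-1)^{d-|S|}\sum_{F\in\Delta_S}\varepsilon_\Delta(F), \] where $\Delta_S=\{F\in\Delta:\kappa(F)\subseteq S\}$ (this includes the empty face).
   Context: A simplicial complex $\Delta$ on a finite vertex set $V(\Delta)$ is a family of subsets closed under taking subsets (faces; the empty set is a face). A $(d-1)$-dimensional simplicial complex is balanced if it is pure (all maximal faces have $d$ vertices) and equipped with $\kappa:V(\Delta)\to[d]=\{1,\ldots,d\}$ such that no two vertices of a face have the same color; $\kappa(F)$ denotes the set of colors of the vertices of $F$. For $S\subseteq[d]$, $f_S(\Delta)$ is the number of faces $F$ with $\kappa(F)=S$, and the flag $h$-numbers are $h_T(\Delta)=\sum_{S\subseteq T}(-1)^{|T|-|S|}f_S(\Delta)$. The link of a face is $\mathrm{lk}_\Delta F=\{G\in\Delta:F\cup G\in\Delta,\ F\cap G=\emptyset\}$, the reduced Euler characteristic is $\tilde\chi(\Gamma)=\sum_{i\ge-1}(-1)^if_i(\Gamma)$ with $f_i$ the number of $i$-dimensional faces, and the error of a face is $\varepsilon_\Delta(F)=\tilde\chi(\mathrm{lk}_\Delta F)-(-1)^{d-1-|F|}$. -}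

module Defs where

open import Data.Bool using (Bool; true; false; _∧_; if_then_else_)
import Data.Bool as B
open import Data.Nat using (ℕ; zero; suc; _∸_)
import Data.Nat as N
open import Data.Integer using (ℤ; +_; _-_; _*_; -_)
import Data.Integer as Z
open import Data.Fin using (Fin; zero; suc)
open import Data.Fin.Subset using (Subset; inside; outside; _∈_; _⊆_; ⊥; ⁅_⁆; _∪_; _∩_; ∣_∣; ∁)
open import Data.Fin.Subset.Properties using (_⊆?_)
open import Data.Vec using (Vec; []; _∷_)
open import Data.Vec.Properties using (≡-dec)
open import Data.List using (List; []; _∷_; map; _++_; foldr)
open import Data.Product using (Σ; _×_; _,_)
open import Relation.Binary.PropositionalEquality using (_≡_)
open import Relation.Nullary.Decidable using (⌊_⌋)

allSubsets : (n : ℕ) → List (Subset n)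
allSubsets zero    = [] ∷ []
allSubsets (suc n) = map (outside ∷_) (allSubsets n) ++ map (inside ∷_) (allSubsets n)

sumOver : {n : ℕ} → (Subset n → Bool) → (Subset n → ℤ) → ℤ
sumOver {n} p f = foldr Z._+_ (+ 0) (map (λ F → if p F then f F else + 0) (allSubsets n))

countOver : {n : ℕ} → (Subset n → Bool) → ℤ
countOver p = sumOver p (λ _ → + 1)

sgn : ℕ → ℤ
sgn zero    = + 1
sgn (suc m) = - sgn m

_=ˢ_ : {n : ℕ} → Subset n → Subset n → Bool
F =ˢ G = ⌊ ≡-dec B._≟_ F G ⌋

_⊆ᵇ_ : {n : ℕ} → Subset n → Subset n → Bool
F ⊆ᵇ G = ⌊ F ⊆? G ⌋

-- Simplicial complexes on the ground set Fin n, given by their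
-- characteristic function on subsets (faces F are those with Δ F ≡ true).

Complex : ℕ → Set
Complex n = Subset n → Bool

IsSimplicialComplex : {n : ℕ} → Complex n → Set
IsSimplicialComplex {n} Δ =
  (Δ ⊥ ≡ true) × ((F G : Subset n) → G ⊆ F → Δ F ≡ true → Δ G ≡ true)

IsPure : {n : ℕ} → ℕ → Complex n → Set
IsPure {n} d Δ =
  (F : Subset n) → Δ F ≡ true →
  ((G : Subset n) → Δ G ≡ true → F ⊆ G → G ≡ F) → ∣ F ∣ ≡ d

IsProperColoring : {n d : ℕ} → Complex n → (Fin n → Fin d) → Set
IsProperColoring {n} Δ κ =
  (F : Subset n) → Δ F ≡ true →
  (u v : Fin n) → u ∈ F → v ∈ F → κ u ≡ κ v → u ≡ v

IsBalanced : {n : ℕ} (d : ℕ) → Complex n → (Fin n → Fin d) → Set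
IsBalanced d Δ κ = IsSimplicialComplex Δ × IsPure d Δ × IsProperColoring Δ κ

colours : {n d : ℕ} → (Fin n → Fin d) → Subset n → Subset d
colours {zero}  κ []      = ⊥
colours {suc n} κ (s ∷ F) with s
... | true  = ⁅ κ zero ⁆ ∪ colours (λ i → κ (suc i)) F
... | false = colours (λ i → κ (suc i)) F

flagF : {n d : ℕ} → Complex n → (Fin n → Fin d) → Subset d → ℤ
flagF Δ κ S = countOver (λ F → Δ F ∧ (colours κ F =ˢ S))

flagH : {n d : ℕ} → Complex n → (Fin n → Fin d) → Subset d → ℤ
flagH Δ κ T = sumOver (λ S → S ⊆ᵇ T) (λ S → sgn (∣ T ∣ ∸ ∣ S ∣) * flagF Δ κ S)

link : {n : ℕ} → Complex n → Subset n → Complex n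
link Δ F G = Δ G ∧ Δ (F ∪ G) ∧ ((F ∩ G) =ˢ ⊥)

-- reduced Euler characteristic: Σ_{G ∈ Γ} (-1)^{dim G}, dim G = |G| - 1;
-- (-1)^{|G|-1} is written (-1)^{|G|+1} (same parity, avoids |∅| - 1 = -1)
redEuler : {n : ℕ} → Complex n → ℤ
redEuler Γ = sumOver Γ (λ G → sgn (suc ∣ G ∣))

-- error ε_Δ(F) = χ̃(lk F) - (-1)^{d-1-|F|};
-- (-1)^{d-1-|F|} is written (-1)^{d+1+|F|} (same parity as an integer exponent)
err : {n : ℕ} → ℕ → Complex n → Subset n → ℤ
err d Δ F = redEuler (link Δ F) - sgn (d N.+ suc ∣ F ∣)

-- Counting faces by their colour sets, h_T(Δ) = (-1)^(|T|-1) χ̃(Δ_T), where Δ_T is the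
-- subcomplex induced on the vertices with colours in T; this uses |κ(F)| = |F| for faces.
-- Writing χ̃(lk F) as a signed sum over the faces H ⊇ F and exchanging the order of
-- summation turns Σ_{F ∈ Δ_S} χ̃(lk F) into Σ_{H ∈ Δ} (-1)^(|H|-1) Σ_{F ⊆ H ∩ κ⁻¹(S)} (-1)^|F|.
-- The inner alternating sum vanishes unless H has no vertex coloured in S, so the total is
-- χ̃(Δ_{S^c}), and the theorem is a rearrangement of signs.
module Submission where

open import Defs
open import Algebra.Properties.CommutativeSemigroup using (interchange)
open import Data.Bool using (Bool; true; false; _∧_; if_then_else_)
open import Data.Bool.Properties using (∧-comm; ∧-identityʳ; ∧-zeroʳ)
import Data.Bool as Bool
open import Data.Empty using (⊥-elim)
open import Data.Fin using (Fin; zero; suc)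
open import Data.Fin.Properties using (suc-injective)
open import Data.Fin.Subset using (Subset; inside; outside; _∈_; _∉_; _⊆_; ⊥; ⁅_⁆; _∪_; _∩_; ∣_∣; ∁)
open import Data.Fin.Subset.Properties
  using (_⊆?_; ∉⊥; x∈p∪q⁻; x∈⁅y⁆⇒x≡y; ∣⊥∣≡0; ∪-identityˡ; ∣p∣≤n; ∣∁p∣≡n∸∣p∣; p⊆q⇒∣p∣≤∣q∣; q⊆p∪q)
open import Data.Integer using (ℤ; +_; _+_; _-_; _*_; -_)
open import Data.Integer.Properties
  using ( +-assoc; +-identityˡ; +-identityʳ; +-inverseʳ; +-commutativeSemigroup
        ; *-identityˡ; *-identityʳ; *-zeroʳ; *-distribˡ-+; neg-distrib-+; neg-distribˡ-*)
open import Data.Integer.Solver using (module +-*-Solver)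
open import Data.List using (List; []; _∷_; map; _++_; foldr)
open import Data.List.Properties using (map-++; map-∘)
open import Data.Nat using (ℕ; zero; suc; _∸_; _≤_; s≤s)
import Data.Nat as ℕ
open import Data.Nat.Properties using (+-suc; m∸n+n≡m)
open import Data.Product using (Σ; _×_; _,_)
open import Data.Sum using (inj₁; inj₂)
open import Data.Vec using ([]; _∷_; lookup; tabulate; here; there)
open import Data.Vec.Properties using (≡-dec; lookup-map; tabulate-cong; tabulate-∘)
open import Function using (_∘_)
open import Relation.Binary.PropositionalEquality
open import Relation.Nullary.Decidable using (⌊_⌋; does; _×-dec_; isYes≗does; ⌊⌋-map′)

open +-*-Solver using (solve; _:-_; _:*_; :-_; _:=_)

private
  variable
    m n : ℕ

sgn-+ : ∀ a b → sgn (a ℕ.+ b) ≡ sgn a * sgn b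
sgn-+ zero    b = sym (*-identityˡ (sgn b))
sgn-+ (suc a) b = trans (cong -_ (sgn-+ a b)) (neg-distribˡ-* (sgn a) (sgn b))

sgn-square : ∀ a → sgn a * sgn a ≡ + 1
sgn-square zero    = refl
sgn-square (suc a) = trans (neg-square (sgn a)) (sgn-square a)
  where
  neg-square : ∀ x → (- x) * (- x) ≡ x * x
  neg-square = solve 1 (λ x → (:- x) :* (:- x) := x :* x) refl

sgn-∸ : ∀ a b → b ≤ a → sgn (a ∸ b) ≡ sgn a * sgn b
sgn-∸ a b b≤a = begin
  sgn (a ∸ b)                    ≡⟨ sym (*-identityʳ _) ⟩
  sgn (a ∸ b) * + 1              ≡⟨ cong (sgn (a ∸ b) *_) (sym (sgn-square b)) ⟩
  sgn (a ∸ b) * (sgn b * sgn b)  ≡⟨ assoc (sgn (a ∸ b)) (sgn b) (sgn b) ⟩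
  sgn (a ∸ b) * sgn b * sgn b    ≡⟨ cong (_* sgn b) (sym (sgn-+ (a ∸ b) b)) ⟩
  sgn (a ∸ b ℕ.+ b) * sgn b      ≡⟨ cong (λ k → sgn k * sgn b) (m∸n+n≡m b≤a) ⟩
  sgn a * sgn b                  ∎
  where
  open ≡-Reasoning
  assoc : ∀ x y z → x * (y * z) ≡ x * y * z
  assoc = solve 3 (λ x y z → x :* (y :* z) := x :* y :* z) refl

sgn-+-cancelˡ : ∀ a b → sgn (a ℕ.+ b) * sgn a ≡ sgn b
sgn-+-cancelˡ a b = begin
  sgn (a ℕ.+ b) * sgn a    ≡⟨ cong (_* sgn a) (sgn-+ a b) ⟩
  sgn a * sgn b * sgn a    ≡⟨ rearrange (sgn a) (sgn b) ⟩
  sgn a * sgn a * sgn b    ≡⟨ cong (_* sgn b) (sgn-square a) ⟩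
  + 1 * sgn b              ≡⟨ *-identityˡ (sgn b) ⟩
  sgn b                    ∎
  where
  open ≡-Reasoning
  rearrange : ∀ x y → x * y * x ≡ x * x * y
  rearrange = solve 2 (λ x y → x :* y :* x := x :* x :* y) refl

-- Iverson brackets

infixr 8 [_]·_

[_]·_ : Bool → ℤ → ℤ
[ b ]· x = if b then x else + 0

[]·-zero : ∀ b → [ b ]· + 0 ≡ + 0
[]·-zero true  = refl
[]·-zero false = refl

[]·-∧ : ∀ a b x → [ a ∧ b ]· x ≡ [ a ]· [ b ]· x
[]·-∧ true  b x = refl
[]·-∧ false b x = refl

[]·-comm : ∀ a b x → [ a ]· [ b ]· x ≡ [ b ]· [ a ]· x
[]·-comm a b x = begin
  [ a ]· [ b ]· x  ≡⟨ sym ([]·-∧ a b x) ⟩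
  [ a ∧ b ]· x     ≡⟨ cong ([_]· x) (∧-comm a b) ⟩
  [ b ∧ a ]· x     ≡⟨ []·-∧ b a x ⟩
  [ b ]· [ a ]· x  ∎
  where open ≡-Reasoning

[]·-absorb : ∀ a b x → (b ≡ true → a ≡ true) → [ a ]· [ b ]· x ≡ [ b ]· x
[]·-absorb a     false x b⇒a = []·-zero a
[]·-absorb a     true  x b⇒a rewrite b⇒a refl = refl

[]·-cong : ∀ b {x y} → (b ≡ true → x ≡ y) → [ b ]· x ≡ [ b ]· y
[]·-cong true  x≡y = x≡y refl
[]·-cong false x≡y = refl

[]·-+ : ∀ b x y → [ b ]· (x + y) ≡ [ b ]· x + [ b ]· y
[]·-+ true  x y = refl
[]·-+ false x y = refl

[]·-neg : ∀ b x → [ b ]· (- x) ≡ - [ b ]· x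
[]·-neg true  x = refl
[]·-neg false x = refl

[]·-*ʳ : ∀ b c x → [ b ]· (c * x) ≡ c * [ b ]· x
[]·-*ʳ true  c x = refl
[]·-*ʳ false c x = sym (*-zeroʳ c)

[]·-*ˡ : ∀ b x c → [ b ]· (x * c) ≡ [ b ]· x * c
[]·-*ˡ true  x c = refl
[]·-*ˡ false x c = refl

*-[]·1 : ∀ x b → x * [ b ]· + 1 ≡ [ b ]· x
*-[]·1 x true  = *-identityʳ x
*-[]·1 x false = *-zeroʳ x

-- Sums over subsets

∑ : (n : ℕ) → (Subset n → ℤ) → ℤ
∑ zero    f = f []
∑ (suc n) f = ∑ n (f ∘ (outside ∷_)) + ∑ n (f ∘ (inside ∷_))

∑-cong : {f g : Subset n → ℤ} → (∀ F → f F ≡ g F) → ∑ n f ≡ ∑ n g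
∑-cong {zero}  f≗g = f≗g []
∑-cong {suc n} f≗g = cong₂ _+_ (∑-cong (f≗g ∘ (outside ∷_))) (∑-cong (f≗g ∘ (inside ∷_)))

∑-zero : ∀ n → ∑ n (λ _ → + 0) ≡ + 0
∑-zero zero    = refl
∑-zero (suc n) = cong₂ _+_ (∑-zero n) (∑-zero n)

∑-+ : (f g : Subset n → ℤ) → ∑ n (λ F → f F + g F) ≡ ∑ n f + ∑ n g
∑-+ {zero}  f g = refl
∑-+ {suc n} f g = trans (cong₂ _+_ (∑-+ fₒ gₒ) (∑-+ fᵢ gᵢ))
                        (interchange +-commutativeSemigroup (∑ n fₒ) (∑ n gₒ) (∑ n fᵢ) (∑ n gᵢ))
  where
  fₒ fᵢ gₒ gᵢ : Subset n → ℤ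
  fₒ = f ∘ (outside ∷_)
  fᵢ = f ∘ (inside ∷_)
  gₒ = g ∘ (outside ∷_)
  gᵢ = g ∘ (inside ∷_)

∑-* : ∀ c (f : Subset n → ℤ) → ∑ n (λ F → c * f F) ≡ c * ∑ n f
∑-* {zero}  c f = refl
∑-* {suc n} c f = trans (cong₂ _+_ (∑-* c (f ∘ (outside ∷_))) (∑-* c (f ∘ (inside ∷_))))
                        (sym (*-distribˡ-+ c (∑ n (f ∘ (outside ∷_))) (∑ n (f ∘ (inside ∷_)))))

∑-neg : (f : Subset n → ℤ) → ∑ n (λ F → - f F) ≡ - ∑ n f
∑-neg {zero}  f = refl
∑-neg {suc n} f = trans (cong₂ _+_ (∑-neg (f ∘ (outside ∷_))) (∑-neg (f ∘ (inside ∷_))))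
                        (sym (neg-distrib-+ (∑ n (f ∘ (outside ∷_))) (∑ n (f ∘ (inside ∷_)))))

∑-comm : (f : Subset m → Subset n → ℤ) → ∑ m (λ F → ∑ n (f F)) ≡ ∑ n (λ G → ∑ m (λ F → f F G))
∑-comm {zero}  f = refl
∑-comm {suc m} f = trans (cong₂ _+_ (∑-comm (f ∘ (outside ∷_))) (∑-comm (f ∘ (inside ∷_))))
                         (sym (∑-+ (λ G → ∑ m (λ F → f (outside ∷ F) G)) (λ G → ∑ m (λ F → f (inside ∷ F) G))))

[]·-∑ : ∀ b (f : Subset n → ℤ) → [ b ]· ∑ n f ≡ ∑ n (λ F → [ b ]· f F)
[]·-∑     true  f = refl
[]·-∑ {n} false f = sym (∑-zero n)

sumOver≡∑ : (p : Subset n → Bool) (f : Subset n → ℤ) → sumOver p f ≡ ∑ n (λ F → [ p F ]· f F)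
sumOver≡∑ {n} p f = sum-allSubsets n (λ F → [ p F ]· f F)
  where
  sumᶻ : List ℤ → ℤ
  sumᶻ = foldr _+_ (+ 0)

  sumᶻ-++ : ∀ xs ys → sumᶻ (xs ++ ys) ≡ sumᶻ xs + sumᶻ ys
  sumᶻ-++ []       ys = sym (+-identityˡ _)
  sumᶻ-++ (x ∷ xs) ys = trans (cong (_+_ x) (sumᶻ-++ xs ys)) (sym (+-assoc x (sumᶻ xs) (sumᶻ ys)))

  sum-allSubsets : ∀ n (g : Subset n → ℤ) → sumᶻ (map g (allSubsets n)) ≡ ∑ n g
  sum-allSubsets zero    g = +-identityʳ (g [])
  sum-allSubsets (suc n) g = begin
    sumᶻ (map g (map (outside ∷_) L ++ map (inside ∷_) L))
      ≡⟨ cong sumᶻ (map-++ g (map (outside ∷_) L) (map (inside ∷_) L)) ⟩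
    sumᶻ (map g (map (outside ∷_) L) ++ map g (map (inside ∷_) L))
      ≡⟨ sumᶻ-++ (map g (map (outside ∷_) L)) _ ⟩
    sumᶻ (map g (map (outside ∷_) L)) + sumᶻ (map g (map (inside ∷_) L))
      ≡⟨ cong₂ (λ xs ys → sumᶻ xs + sumᶻ ys) (sym (map-∘ L)) (sym (map-∘ L)) ⟩
    sumᶻ (map (g ∘ (outside ∷_)) L) + sumᶻ (map (g ∘ (inside ∷_)) L)
      ≡⟨ cong₂ _+_ (sum-allSubsets n (g ∘ (outside ∷_))) (sum-allSubsets n (g ∘ (inside ∷_))) ⟩
    ∑ (suc n) g ∎
    where
    open ≡-Reasoning
    L = allSubsets n

sumOver-cong : {p q : Subset n → Bool} (f : Subset n → ℤ) → (∀ F → p F ≡ q F) → sumOver p f ≡ sumOver q f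
sumOver-cong {p = p} {q} f p≗q = begin
  sumOver p f                    ≡⟨ sumOver≡∑ p f ⟩
  ∑ _ (λ F → [ p F ]· f F)       ≡⟨ ∑-cong (λ F → cong ([_]· f F) (p≗q F)) ⟩
  ∑ _ (λ F → [ q F ]· f F)       ≡⟨ sym (sumOver≡∑ q f) ⟩
  sumOver q f                    ∎
  where open ≡-Reasoning

-- Structural counterparts of _⊆ᵇ_ and _=ˢ_: unlike those, they compute on cons cells.
infix 5 _⊑_ _≐_

_⊑_ : Subset n → Subset n → Bool
[]            ⊑ []      = true
(outside ∷ p) ⊑ (_ ∷ q) = p ⊑ q
(inside  ∷ p) ⊑ (y ∷ q) = y ∧ (p ⊑ q)

_≐_ : Subset n → Subset n → Bool
[]      ≐ []      = true
(x ∷ p) ≐ (y ∷ q) = ⌊ x Bool.≟ y ⌋ ∧ (p ≐ q)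

⊆ᵇ≡⊑ : (p q : Subset n) → p ⊆ᵇ q ≡ p ⊑ q
⊆ᵇ≡⊑ []            []            = refl
⊆ᵇ≡⊑ (outside ∷ p) (y ∷ q)       = trans (⌊⌋-map′ _ _ (p ⊆? q)) (⊆ᵇ≡⊑ p q)
⊆ᵇ≡⊑ (inside  ∷ p) (outside ∷ q) = refl
⊆ᵇ≡⊑ (inside  ∷ p) (inside  ∷ q) = trans (⌊⌋-map′ _ _ (p ⊆? q)) (⊆ᵇ≡⊑ p q)

=ˢ≡≐ : (p q : Subset n) → p =ˢ q ≡ p ≐ q
=ˢ≡≐ []      []      = refl
=ˢ≡≐ (x ∷ p) (y ∷ q) = begin
  ⌊ ≡-dec Bool._≟_ (x ∷ p) (y ∷ q) ⌋                ≡⟨ ⌊⌋-map′ _ _ (x≟y ×-dec p≟q) ⟩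
  ⌊ x≟y ×-dec p≟q ⌋                                 ≡⟨ isYes≗does (x≟y ×-dec p≟q) ⟩
  does x≟y ∧ does p≟q                               ≡⟨ cong₂ _∧_ (sym (isYes≗does x≟y)) (sym (isYes≗does p≟q)) ⟩
  ⌊ x≟y ⌋ ∧ p =ˢ q                                  ≡⟨ cong (⌊ x≟y ⌋ ∧_) (=ˢ≡≐ p q) ⟩
  ⌊ x≟y ⌋ ∧ (p ≐ q)                                 ∎
  where
  open ≡-Reasoning
  x≟y = x Bool.≟ y
  p≟q = ≡-dec Bool._≟_ p q

⊑⇒⊆ : (p q : Subset n) → p ⊑ q ≡ true → p ⊆ q
⊑⇒⊆ (outside ∷ p) (y      ∷ q) p⊑q (there x∈p) = there (⊑⇒⊆ p q p⊑q x∈p)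
⊑⇒⊆ (inside  ∷ p) (inside ∷ q) p⊑q here        = here
⊑⇒⊆ (inside  ∷ p) (inside ∷ q) p⊑q (there x∈p) = there (⊑⇒⊆ p q p⊑q x∈p)

⊥⊑ : (q : Subset n) → ⊥ ⊑ q ≡ true
⊥⊑ []      = refl
⊥⊑ (y ∷ q) = ⊥⊑ q

⁅⁆⊑ : (x : Fin n) (q : Subset n) → ⁅ x ⁆ ⊑ q ≡ lookup q x
⁅⁆⊑ zero    (y ∷ q) = trans (cong (y ∧_) (⊥⊑ q)) (∧-identityʳ y)
⁅⁆⊑ (suc x) (y ∷ q) = ⁅⁆⊑ x q

∪⊑ : (p q r : Subset n) → p ∪ q ⊑ r ≡ (p ⊑ r) ∧ (q ⊑ r)
∪⊑ []            []            []            = refl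
∪⊑ (outside ∷ p) (outside ∷ q) (z       ∷ r) = ∪⊑ p q r
∪⊑ (outside ∷ p) (inside  ∷ q) (outside ∷ r) = sym (∧-zeroʳ (p ⊑ r))
∪⊑ (outside ∷ p) (inside  ∷ q) (inside  ∷ r) = ∪⊑ p q r
∪⊑ (inside  ∷ p) (y       ∷ q) (outside ∷ r) = refl
∪⊑ (inside  ∷ p) (outside ∷ q) (inside  ∷ r) = ∪⊑ p q r
∪⊑ (inside  ∷ p) (inside  ∷ q) (inside  ∷ r) = ∪⊑ p q r

⊑-∩ : (p q r : Subset n) → p ⊑ q ∩ r ≡ (p ⊑ q) ∧ (p ⊑ r)
⊑-∩ []            []            []            = refl
⊑-∩ (outside ∷ p) (y       ∷ q) (z       ∷ r) = ⊑-∩ p q r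
⊑-∩ (inside  ∷ p) (outside ∷ q) (z       ∷ r) = refl
⊑-∩ (inside  ∷ p) (inside  ∷ q) (outside ∷ r) = sym (∧-zeroʳ (p ⊑ q))
⊑-∩ (inside  ∷ p) (inside  ∷ q) (inside  ∷ r) = ⊑-∩ p q r

∩≐⊥≡⊑∁ : (p q : Subset n) → p ∩ q ≐ ⊥ ≡ p ⊑ ∁ q
∩≐⊥≡⊑∁ []            []            = refl
∩≐⊥≡⊑∁ (outside ∷ p) (y       ∷ q) = ∩≐⊥≡⊑∁ p q
∩≐⊥≡⊑∁ (inside  ∷ p) (outside ∷ q) = ∩≐⊥≡⊑∁ p q
∩≐⊥≡⊑∁ (inside  ∷ p) (inside  ∷ q) = refl

∣∪∣-disjoint : (p q : Subset n) → p ∩ q ≐ ⊥ ≡ true → ∣ p ∪ q ∣ ≡ ∣ p ∣ ℕ.+ ∣ q ∣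
∣∪∣-disjoint []            []            _ = refl
∣∪∣-disjoint (outside ∷ p) (outside ∷ q) d = ∣∪∣-disjoint p q d
∣∪∣-disjoint (outside ∷ p) (inside  ∷ q) d = trans (cong suc (∣∪∣-disjoint p q d)) (sym (+-suc ∣ p ∣ ∣ q ∣))
∣∪∣-disjoint (inside  ∷ p) (outside ∷ q) d = cong suc (∣∪∣-disjoint p q d)

∑-δ : (X : Subset n) (g : Subset n → ℤ) → ∑ n (λ G → [ X ≐ G ]· g G) ≡ g X
∑-δ []            g = refl
∑-δ {suc n} (outside ∷ X) g =
  trans (cong₂ _+_ (∑-δ X (g ∘ (outside ∷_))) (∑-zero n)) (+-identityʳ (g (outside ∷ X)))
∑-δ {suc n} (inside  ∷ X) g =
  trans (cong₂ _+_ (∑-zero n) (∑-δ X (g ∘ (inside ∷_)))) (+-identityˡ (g (inside ∷ X)))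

∑-alternating : (X : Subset n) → ∑ n (λ F → [ F ⊑ X ]· sgn ∣ F ∣) ≡ [ X ≐ ⊥ ]· + 1
∑-alternating []            = refl
∑-alternating {suc n} (outside ∷ X) =
  trans (cong₂ _+_ (∑-alternating X) (∑-zero n)) (+-identityʳ ([ X ≐ ⊥ ]· + 1))
∑-alternating {suc n} (inside ∷ X) = begin
  A + ∑ n (λ F → [ F ⊑ X ]· (- sgn ∣ F ∣))  ≡⟨ cong (_+_ A) (∑-cong (λ F → []·-neg (F ⊑ X) (sgn ∣ F ∣))) ⟩
  A + ∑ n (λ F → - [ F ⊑ X ]· sgn ∣ F ∣)    ≡⟨ cong (_+_ A) (∑-neg (λ F → [ F ⊑ X ]· sgn ∣ F ∣)) ⟩
  A - A                                      ≡⟨ +-inverseʳ A ⟩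
  + 0                                        ∎
  where
  open ≡-Reasoning
  A = ∑ n (λ F → [ F ⊑ X ]· sgn ∣ F ∣)

∑-disjoint-∪ : (F : Subset n) (h : Subset n → ℤ) →
               ∑ n (λ G → [ F ∩ G ≐ ⊥ ]· h (F ∪ G)) ≡ ∑ n (λ H → [ F ⊑ H ]· h H)
∑-disjoint-∪ []            h = refl
∑-disjoint-∪ (outside ∷ F) h =
  cong₂ _+_ (∑-disjoint-∪ F (h ∘ (outside ∷_))) (∑-disjoint-∪ F (h ∘ (inside ∷_)))
∑-disjoint-∪ {suc n} (inside ∷ F) h = begin
  ∑ n (λ G → [ F ∩ G ≐ ⊥ ]· h (inside ∷ F ∪ G)) + ∑ n (λ _ → + 0)
    ≡⟨ cong₂ _+_ (∑-disjoint-∪ F (h ∘ (inside ∷_))) (∑-zero n) ⟩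
  A + + 0              ≡⟨ +-identityʳ A ⟩
  A                    ≡⟨ sym (+-identityˡ A) ⟩
  + 0 + A              ≡⟨ cong (_+ A) (sym (∑-zero n)) ⟩
  ∑ n (λ _ → + 0) + A  ∎
  where
  open ≡-Reasoning
  A = ∑ n (λ H → [ F ⊑ H ]· h (inside ∷ H))

∑-fibres : (φ : Subset n → Subset m) (p : Subset n → Bool) (w : Subset m → ℤ) →
           ∑ m (λ S → w S * ∑ n (λ F → [ p F ∧ (φ F ≐ S) ]· + 1)) ≡ ∑ n (λ F → [ p F ]· w (φ F))
∑-fibres {n} {m} φ p w = begin
  ∑ m (λ S → w S * ∑ n (λ F → [ p F ∧ (φ F ≐ S) ]· + 1))
    ≡⟨ ∑-cong (λ S → sym (∑-* (w S) (λ F → [ p F ∧ (φ F ≐ S) ]· + 1))) ⟩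
  ∑ m (λ S → ∑ n (λ F → w S * [ p F ∧ (φ F ≐ S) ]· + 1))
    ≡⟨ ∑-comm (λ S F → w S * [ p F ∧ (φ F ≐ S) ]· + 1) ⟩
  ∑ n (λ F → ∑ m (λ S → w S * [ p F ∧ (φ F ≐ S) ]· + 1))
    ≡⟨ ∑-cong (λ F → ∑-cong (λ S → trans (*-[]·1 (w S) _) ([]·-∧ (p F) (φ F ≐ S) (w S)))) ⟩
  ∑ n (λ F → ∑ m (λ S → [ p F ]· [ φ F ≐ S ]· w S))
    ≡⟨ ∑-cong (λ F → sym ([]·-∑ (p F) (λ S → [ φ F ≐ S ]· w S))) ⟩
  ∑ n (λ F → [ p F ]· ∑ m (λ S → [ φ F ≐ S ]· w S))
    ≡⟨ ∑-cong (λ F → cong ([ p F ]·_) (∑-δ (φ F) w)) ⟩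
  ∑ n (λ F → [ p F ]· w (φ F))
    ∎
  where open ≡-Reasoning

preimage : (Fin n → Fin m) → Subset m → Subset n
preimage κ T = tabulate (λ v → lookup T (κ v))

colours⊑≡⊑preimage : (κ : Fin n → Fin m) (F : Subset n) (T : Subset m) →
                     colours κ F ⊑ T ≡ F ⊑ preimage κ T
colours⊑≡⊑preimage {zero}  κ []            T = ⊥⊑ T
colours⊑≡⊑preimage {suc n} κ (outside ∷ F) T = colours⊑≡⊑preimage (κ ∘ suc) F T
colours⊑≡⊑preimage {suc n} κ (inside  ∷ F) T =
  trans (∪⊑ ⁅ κ zero ⁆ (colours (κ ∘ suc) F) T)
        (cong₂ _∧_ (⁅⁆⊑ (κ zero) T) (colours⊑≡⊑preimage (κ ∘ suc) F T))

preimage-∁ : (κ : Fin n → Fin m) (S : Subset m) → preimage κ (∁ S) ≡ ∁ (preimage κ S)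
preimage-∁ κ S = trans (tabulate-cong (λ v → lookup-map (κ v) Bool.not S))
                       (tabulate-∘ Bool.not (λ v → lookup S (κ v)))

∈colours⁻ : (κ : Fin n → Fin m) (F : Subset n) {c : Fin m} →
            c ∈ colours κ F → Σ (Fin n) (λ v → v ∈ F × κ v ≡ c)
∈colours⁻ {zero}  κ []            c∈ = ⊥-elim (∉⊥ c∈)
∈colours⁻ {suc n} κ (outside ∷ F) c∈ with ∈colours⁻ (κ ∘ suc) F c∈
... | v , v∈F , κv≡c = suc v , there v∈F , κv≡c
∈colours⁻ {suc n} κ (inside  ∷ F) c∈ with x∈p∪q⁻ ⁅ κ zero ⁆ (colours (κ ∘ suc) F) c∈
... | inj₁ c∈⁅κ0⁆ = zero , here , sym (x∈⁅y⁆⇒x≡y (κ zero) c∈⁅κ0⁆)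
... | inj₂ c∈rest with ∈colours⁻ (κ ∘ suc) F c∈rest
...   | v , v∈F , κv≡c = suc v , there v∈F , κv≡c

∣⁅x⁆∪p∣≡1+∣p∣ : (x : Fin m) (p : Subset m) → x ∉ p → ∣ ⁅ x ⁆ ∪ p ∣ ≡ suc ∣ p ∣
∣⁅x⁆∪p∣≡1+∣p∣ zero    (inside  ∷ p) x∉p = ⊥-elim (x∉p here)
∣⁅x⁆∪p∣≡1+∣p∣ zero    (outside ∷ p) x∉p = cong (suc ∘ ∣_∣) (∪-identityˡ p)
∣⁅x⁆∪p∣≡1+∣p∣ (suc x) (inside  ∷ p) x∉p = cong suc (∣⁅x⁆∪p∣≡1+∣p∣ x p (x∉p ∘ there))
∣⁅x⁆∪p∣≡1+∣p∣ (suc x) (outside ∷ p) x∉p = ∣⁅x⁆∪p∣≡1+∣p∣ x p (x∉p ∘ there)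

InjectiveOn : (Fin n → Fin m) → Subset n → Set
InjectiveOn {n} κ F = (u v : Fin n) → u ∈ F → v ∈ F → κ u ≡ κ v → u ≡ v

injectiveOn-tail : {κ : Fin (suc n) → Fin m} {x : Bool} {F : Subset n} →
                   InjectiveOn κ (x ∷ F) → InjectiveOn (κ ∘ suc) F
injectiveOn-tail inj u v u∈F v∈F κu≡κv = suc-injective (inj (suc u) (suc v) (there u∈F) (there v∈F) κu≡κv)

∣colours∣≡∣∣ : (κ : Fin n → Fin m) (F : Subset n) → InjectiveOn κ F → ∣ colours κ F ∣ ≡ ∣ F ∣
∣colours∣≡∣∣ {zero} {m} κ []            _   = ∣⊥∣≡0 m
∣colours∣≡∣∣ {suc n}    κ (outside ∷ F) inj = ∣colours∣≡∣∣ (κ ∘ suc) F (injectiveOn-tail inj)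
∣colours∣≡∣∣ {suc n}    κ (inside  ∷ F) inj =
  trans (∣⁅x⁆∪p∣≡1+∣p∣ (κ zero) (colours (κ ∘ suc) F) κ0∉)
        (cong suc (∣colours∣≡∣∣ (κ ∘ suc) F (injectiveOn-tail inj)))
  where
  κ0∉ : κ zero ∉ colours (κ ∘ suc) F
  κ0∉ κ0∈ with ∈colours⁻ (κ ∘ suc) F κ0∈
  ... | v , v∈F , κv≡κ0 with inj (suc v) zero (there v∈F) here κv≡κ0
  ... | ()

-- Subcomplexes and links

IsDownwardClosed : Complex n → Set
IsDownwardClosed {n} Δ = (F G : Subset n) → G ⊆ F → Δ F ≡ true → Δ G ≡ true

induced : Complex n → Subset n → Complex n
induced Δ K F = Δ F ∧ (F ⊑ K)

redEuler-link : (Δ : Complex n) → IsDownwardClosed Δ → (F : Subset n) →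
                redEuler (link Δ F) ≡ ∑ n (λ H → [ F ⊑ H ]· [ Δ H ]· (sgn (suc ∣ H ∣) * sgn ∣ F ∣))
redEuler-link {n} Δ closed F = begin
  redEuler (link Δ F)                          ≡⟨ sumOver≡∑ (link Δ F) (λ G → sgn (suc ∣ G ∣)) ⟩
  ∑ n (λ G → [ link Δ F G ]· sgn (suc ∣ G ∣))  ≡⟨ ∑-cong term ⟩
  ∑ n (λ G → [ F ∩ G ≐ ⊥ ]· h (F ∪ G))         ≡⟨ ∑-disjoint-∪ F h ⟩
  ∑ n (λ H → [ F ⊑ H ]· h H)                   ∎
  where
  open ≡-Reasoning
  h : Subset n → ℤ
  h H = [ Δ H ]· (sgn (suc ∣ H ∣) * sgn ∣ F ∣)

  sign : ∀ G → F ∩ G ≐ ⊥ ≡ true → sgn (suc ∣ G ∣) ≡ sgn (suc ∣ F ∪ G ∣) * sgn ∣ F ∣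
  sign G disjoint = begin
    sgn (suc ∣ G ∣)                       ≡⟨ sym (sgn-+-cancelˡ ∣ F ∣ (suc ∣ G ∣)) ⟩
    sgn (∣ F ∣ ℕ.+ suc ∣ G ∣) * sgn ∣ F ∣  ≡⟨ cong (λ k → sgn k * sgn ∣ F ∣) (+-suc ∣ F ∣ ∣ G ∣) ⟩
    sgn (suc (∣ F ∣ ℕ.+ ∣ G ∣)) * sgn ∣ F ∣ ≡⟨ cong (λ k → sgn (suc k) * sgn ∣ F ∣) (sym (∣∪∣-disjoint F G disjoint)) ⟩
    sgn (suc ∣ F ∪ G ∣) * sgn ∣ F ∣        ∎

  term : ∀ G → [ link Δ F G ]· sgn (suc ∣ G ∣) ≡ [ F ∩ G ≐ ⊥ ]· h (F ∪ G)
  term G = begin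
    [ Δ G ∧ Δ (F ∪ G) ∧ ((F ∩ G) =ˢ ⊥) ]· s
      ≡⟨ trans ([]·-∧ (Δ G) _ s) (cong ([ Δ G ]·_) ([]·-∧ (Δ (F ∪ G)) _ s)) ⟩
    [ Δ G ]· [ Δ (F ∪ G) ]· [ (F ∩ G) =ˢ ⊥ ]· s
      ≡⟨ []·-absorb (Δ G) (Δ (F ∪ G)) _ (closed (F ∪ G) G (q⊆p∪q F G)) ⟩
    [ Δ (F ∪ G) ]· [ (F ∩ G) =ˢ ⊥ ]· s
      ≡⟨ []·-comm (Δ (F ∪ G)) _ s ⟩
    [ (F ∩ G) =ˢ ⊥ ]· [ Δ (F ∪ G) ]· s
      ≡⟨ cong (λ b → [ b ]· [ Δ (F ∪ G) ]· s) (=ˢ≡≐ (F ∩ G) ⊥) ⟩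
    [ F ∩ G ≐ ⊥ ]· [ Δ (F ∪ G) ]· s
      ≡⟨ []·-cong (F ∩ G ≐ ⊥) (cong ([ Δ (F ∪ G) ]·_) ∘ sign G) ⟩
    [ F ∩ G ≐ ⊥ ]· h (F ∪ G)
      ∎
    where s = sgn (suc ∣ G ∣)

[]·-subface : (Δ : Complex n) → IsDownwardClosed Δ → (K F H : Subset n) (x : ℤ) →
            [ induced Δ K F ]· [ F ⊑ H ]· [ Δ H ]· x ≡ [ Δ H ]· [ F ⊑ H ∩ K ]· x
[]·-subface Δ closed K F H x rewrite ⊑-∩ F H K with F ⊑ H in F⊑H | Δ H in H∈Δ
... | false | _     = trans ([]·-zero (induced Δ K F)) (sym ([]·-zero _))
... | true  | false = []·-zero (induced Δ K F)
... | true  | true  = cong (λ b → [ b ∧ (F ⊑ K) ]· x) (closed H F (⊑⇒⊆ F H F⊑H) H∈Δ)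

∑-induced-below : (Δ : Complex n) → IsDownwardClosed Δ → (K H : Subset n) →
  ∑ n (λ F → [ induced Δ K F ]· [ F ⊑ H ]· [ Δ H ]· (sgn (suc ∣ H ∣) * sgn ∣ F ∣))
    ≡ [ induced Δ (∁ K) H ]· sgn (suc ∣ H ∣)
∑-induced-below {n} Δ closed K H = begin
  ∑ n (λ F → [ induced Δ K F ]· [ F ⊑ H ]· [ Δ H ]· (s * sgn ∣ F ∣))
    ≡⟨ ∑-cong (λ F → []·-subface Δ closed K F H (s * sgn ∣ F ∣)) ⟩
  ∑ n (λ F → [ Δ H ]· [ F ⊑ H ∩ K ]· (s * sgn ∣ F ∣))
    ≡⟨ ∑-cong (λ F → cong ([ Δ H ]·_) ([]·-*ʳ (F ⊑ H ∩ K) s (sgn ∣ F ∣))) ⟩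
  ∑ n (λ F → [ Δ H ]· (s * [ F ⊑ H ∩ K ]· sgn ∣ F ∣))
    ≡⟨ sym ([]·-∑ (Δ H) (λ F → s * [ F ⊑ H ∩ K ]· sgn ∣ F ∣)) ⟩
  [ Δ H ]· ∑ n (λ F → s * [ F ⊑ H ∩ K ]· sgn ∣ F ∣)
    ≡⟨ cong ([ Δ H ]·_) (∑-* s (λ F → [ F ⊑ H ∩ K ]· sgn ∣ F ∣)) ⟩
  [ Δ H ]· (s * ∑ n (λ F → [ F ⊑ H ∩ K ]· sgn ∣ F ∣))
    ≡⟨ cong (λ z → [ Δ H ]· (s * z)) (∑-alternating (H ∩ K)) ⟩
  [ Δ H ]· (s * [ H ∩ K ≐ ⊥ ]· + 1)
    ≡⟨ cong ([ Δ H ]·_) (trans (*-[]·1 s (H ∩ K ≐ ⊥)) (cong ([_]· s) (∩≐⊥≡⊑∁ H K))) ⟩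
  [ Δ H ]· [ H ⊑ ∁ K ]· s
    ≡⟨ sym ([]·-∧ (Δ H) (H ⊑ ∁ K) s) ⟩
  [ induced Δ (∁ K) H ]· s
    ∎
  where
  open ≡-Reasoning
  s = sgn (suc ∣ H ∣)

∑-redEuler-link : (Δ : Complex n) → IsDownwardClosed Δ → (K : Subset n) →
                  sumOver (induced Δ K) (λ F → redEuler (link Δ F)) ≡ redEuler (induced Δ (∁ K))
∑-redEuler-link {n} Δ closed K = begin
  sumOver (induced Δ K) (λ F → redEuler (link Δ F))
    ≡⟨ sumOver≡∑ (induced Δ K) (λ F → redEuler (link Δ F)) ⟩
  ∑ n (λ F → [ induced Δ K F ]· redEuler (link Δ F))
    ≡⟨ ∑-cong (λ F → cong ([ induced Δ K F ]·_) (redEuler-link Δ closed F)) ⟩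
  ∑ n (λ F → [ induced Δ K F ]· ∑ n (λ H → [ F ⊑ H ]· w F H))
    ≡⟨ ∑-cong (λ F → []·-∑ (induced Δ K F) (λ H → [ F ⊑ H ]· w F H)) ⟩
  ∑ n (λ F → ∑ n (λ H → [ induced Δ K F ]· [ F ⊑ H ]· w F H))
    ≡⟨ ∑-comm (λ F H → [ induced Δ K F ]· [ F ⊑ H ]· w F H) ⟩
  ∑ n (λ H → ∑ n (λ F → [ induced Δ K F ]· [ F ⊑ H ]· w F H))
    ≡⟨ ∑-cong (∑-induced-below Δ closed K) ⟩
  ∑ n (λ H → [ induced Δ (∁ K) H ]· sgn (suc ∣ H ∣))
    ≡⟨ sym (sumOver≡∑ (induced Δ (∁ K)) (λ H → sgn (suc ∣ H ∣))) ⟩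
  redEuler (induced Δ (∁ K))
    ∎
  where
  open ≡-Reasoning
  w : Subset n → Subset n → ℤ
  w F H = [ Δ H ]· (sgn (suc ∣ H ∣) * sgn ∣ F ∣)

-- Flag h-numbers and errors

flagH≡∑colours : (Δ : Complex n) (κ : Fin n → Fin m) (T : Subset m) →
  flagH Δ κ T ≡ ∑ n (λ F → [ Δ F ]· [ colours κ F ⊑ T ]· sgn (∣ T ∣ ∸ ∣ colours κ F ∣))
flagH≡∑colours {n} {m} Δ κ T = begin
  flagH Δ κ T
    ≡⟨ sumOver≡∑ (_⊆ᵇ T) (λ S → sgn (∣ T ∣ ∸ ∣ S ∣) * flagF Δ κ S) ⟩
  ∑ m (λ S → [ S ⊆ᵇ T ]· (sgn (∣ T ∣ ∸ ∣ S ∣) * flagF Δ κ S))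
    ≡⟨ ∑-cong term ⟩
  ∑ m (λ S → w S * ∑ n (λ F → [ Δ F ∧ (colours κ F ≐ S) ]· + 1))
    ≡⟨ ∑-fibres (colours κ) Δ w ⟩
  ∑ n (λ F → [ Δ F ]· w (colours κ F))
    ∎
  where
  open ≡-Reasoning
  w : Subset m → ℤ
  w S = [ S ⊑ T ]· sgn (∣ T ∣ ∸ ∣ S ∣)

  flagF≡∑ : ∀ S → flagF Δ κ S ≡ ∑ n (λ F → [ Δ F ∧ (colours κ F ≐ S) ]· + 1)
  flagF≡∑ S = trans (sumOver≡∑ (λ F → Δ F ∧ (colours κ F =ˢ S)) (λ _ → + 1))
                    (∑-cong (λ F → cong (λ b → [ Δ F ∧ b ]· + 1) (=ˢ≡≐ (colours κ F) S)))

  term : ∀ S → [ S ⊆ᵇ T ]· (sgn (∣ T ∣ ∸ ∣ S ∣) * flagF Δ κ S)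
               ≡ w S * ∑ n (λ F → [ Δ F ∧ (colours κ F ≐ S) ]· + 1)
  term S = trans (cong₂ (λ b f → [ b ]· (sgn (∣ T ∣ ∸ ∣ S ∣) * f)) (⊆ᵇ≡⊑ S T) (flagF≡∑ S))
                 ([]·-*ˡ (S ⊑ T) (sgn (∣ T ∣ ∸ ∣ S ∣)) _)

flagH≡sgn*redEuler : (Δ : Complex n) (κ : Fin n → Fin m) → IsProperColoring Δ κ → (T : Subset m) →
                     flagH Δ κ T ≡ sgn (suc ∣ T ∣) * redEuler (induced Δ (preimage κ T))
flagH≡sgn*redEuler {n} Δ κ proper T = begin
  flagH Δ κ T
    ≡⟨ flagH≡∑colours Δ κ T ⟩
  ∑ n (λ F → [ Δ F ]· [ colours κ F ⊑ T ]· sgn (∣ T ∣ ∸ ∣ colours κ F ∣))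
    ≡⟨ ∑-cong term ⟩
  ∑ n (λ F → sgn (suc ∣ T ∣) * [ induced Δ P F ]· sgn (suc ∣ F ∣))
    ≡⟨ ∑-* (sgn (suc ∣ T ∣)) (λ F → [ induced Δ P F ]· sgn (suc ∣ F ∣)) ⟩
  sgn (suc ∣ T ∣) * ∑ n (λ F → [ induced Δ P F ]· sgn (suc ∣ F ∣))
    ≡⟨ cong (sgn (suc ∣ T ∣) *_) (sym (sumOver≡∑ (induced Δ P) (λ F → sgn (suc ∣ F ∣)))) ⟩
  sgn (suc ∣ T ∣) * redEuler (induced Δ P)
    ∎
  where
  open ≡-Reasoning
  P = preimage κ T

  sign : ∀ F → Δ F ≡ true → F ⊑ P ≡ true →
         sgn (∣ T ∣ ∸ ∣ colours κ F ∣) ≡ sgn (suc ∣ T ∣) * sgn (suc ∣ F ∣)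
  sign F F∈Δ F⊑P = begin
    sgn (suc ∣ T ∣ ∸ suc ∣ colours κ F ∣)      ≡⟨ sgn-∸ (suc ∣ T ∣) (suc ∣ colours κ F ∣) (s≤s ∣κF∣≤∣T∣) ⟩
    sgn (suc ∣ T ∣) * sgn (suc ∣ colours κ F ∣) ≡⟨ cong (λ k → sgn (suc ∣ T ∣) * sgn (suc k)) (∣colours∣≡∣∣ κ F (proper F F∈Δ)) ⟩
    sgn (suc ∣ T ∣) * sgn (suc ∣ F ∣)           ∎
    where
    ∣κF∣≤∣T∣ = p⊆q⇒∣p∣≤∣q∣ (⊑⇒⊆ (colours κ F) T (trans (colours⊑≡⊑preimage κ F T) F⊑P))

  term : ∀ F → [ Δ F ]· [ colours κ F ⊑ T ]· sgn (∣ T ∣ ∸ ∣ colours κ F ∣)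
               ≡ sgn (suc ∣ T ∣) * [ induced Δ P F ]· sgn (suc ∣ F ∣)
  term F = begin
    [ Δ F ]· [ colours κ F ⊑ T ]· sgn (∣ T ∣ ∸ ∣ colours κ F ∣)
      ≡⟨ cong (λ b → [ Δ F ]· [ b ]· sgn (∣ T ∣ ∸ ∣ colours κ F ∣)) (colours⊑≡⊑preimage κ F T) ⟩
    [ Δ F ]· [ F ⊑ P ]· sgn (∣ T ∣ ∸ ∣ colours κ F ∣)
      ≡⟨ []·-cong (Δ F) (λ F∈Δ → []·-cong (F ⊑ P) (sign F F∈Δ)) ⟩
    [ Δ F ]· [ F ⊑ P ]· (sᵀ * sgn (suc ∣ F ∣))
      ≡⟨ cong ([ Δ F ]·_) ([]·-*ʳ (F ⊑ P) sᵀ (sgn (suc ∣ F ∣))) ⟩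
    [ Δ F ]· (sᵀ * [ F ⊑ P ]· sgn (suc ∣ F ∣))
      ≡⟨ []·-*ʳ (Δ F) sᵀ _ ⟩
    sᵀ * [ Δ F ]· [ F ⊑ P ]· sgn (suc ∣ F ∣)
      ≡⟨ cong (sᵀ *_) (sym ([]·-∧ (Δ F) (F ⊑ P) (sgn (suc ∣ F ∣)))) ⟩
    sᵀ * [ induced Δ P F ]· sgn (suc ∣ F ∣)
      ∎
    where sᵀ = sgn (suc ∣ T ∣)

sumOver-err : (d : ℕ) (Δ : Complex n) (p : Subset n → Bool) →
              sumOver p (err d Δ) ≡ sumOver p (λ F → redEuler (link Δ F)) - sgn d * redEuler p
sumOver-err {n} d Δ p = begin
  sumOver p (err d Δ)
    ≡⟨ sumOver≡∑ p (err d Δ) ⟩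
  ∑ n (λ F → [ p F ]· (χ F - sgn (d ℕ.+ suc ∣ F ∣)))
    ≡⟨ ∑-cong term ⟩
  ∑ n (λ F → [ p F ]· χ F + - (sgn d * [ p F ]· sgn (suc ∣ F ∣)))
    ≡⟨ ∑-+ (λ F → [ p F ]· χ F) (λ F → - (sgn d * [ p F ]· sgn (suc ∣ F ∣))) ⟩
  ∑ n (λ F → [ p F ]· χ F) + ∑ n (λ F → - (sgn d * [ p F ]· sgn (suc ∣ F ∣)))
    ≡⟨ cong (_+_ (∑ n (λ F → [ p F ]· χ F))) (∑-neg (λ F → sgn d * [ p F ]· sgn (suc ∣ F ∣))) ⟩
  ∑ n (λ F → [ p F ]· χ F) - ∑ n (λ F → sgn d * [ p F ]· sgn (suc ∣ F ∣))
    ≡⟨ cong (_-_ (∑ n (λ F → [ p F ]· χ F))) (∑-* (sgn d) (λ F → [ p F ]· sgn (suc ∣ F ∣))) ⟩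
  ∑ n (λ F → [ p F ]· χ F) - sgn d * ∑ n (λ F → [ p F ]· sgn (suc ∣ F ∣))
    ≡⟨ sym (cong₂ (λ x y → x - sgn d * y) (sumOver≡∑ p χ) (sumOver≡∑ p (λ F → sgn (suc ∣ F ∣)))) ⟩
  sumOver p χ - sgn d * redEuler p
    ∎
  where
  open ≡-Reasoning
  χ : Subset n → ℤ
  χ F = redEuler (link Δ F)

  term : ∀ F → [ p F ]· (χ F - sgn (d ℕ.+ suc ∣ F ∣)) ≡ [ p F ]· χ F + - (sgn d * [ p F ]· sgn (suc ∣ F ∣))
  term F = begin
    [ p F ]· (χ F - sgn (d ℕ.+ suc ∣ F ∣))
      ≡⟨ []·-+ (p F) (χ F) _ ⟩
    [ p F ]· χ F + [ p F ]· (- sgn (d ℕ.+ suc ∣ F ∣))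
      ≡⟨ cong (_+_ ([ p F ]· χ F)) ([]·-neg (p F) _) ⟩
    [ p F ]· χ F + - [ p F ]· sgn (d ℕ.+ suc ∣ F ∣)
      ≡⟨ cong (λ z → [ p F ]· χ F + - [ p F ]· z) (sgn-+ d (suc ∣ F ∣)) ⟩
    [ p F ]· χ F + - [ p F ]· (sgn d * sgn (suc ∣ F ∣))
      ≡⟨ cong (λ z → [ p F ]· χ F + - z) ([]·-*ʳ (p F) (sgn d) _) ⟩
    [ p F ]· χ F + - (sgn d * [ p F ]· sgn (suc ∣ F ∣))
      ∎

sign-rearrangement : ∀ δ σ u A B → δ * δ ≡ + 1 → u ≡ δ * σ → - σ * A - - u * B ≡ u * (B - δ * A)
sign-rearrangement δ σ u A B δ²≡1 refl = begin
  - σ * A - - (δ * σ) * B            ≡⟨ cong (_- - (δ * σ) * B) (sym (*-identityˡ (- σ * A))) ⟩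
  + 1 * (- σ * A) - - (δ * σ) * B    ≡⟨ cong (λ z → z * (- σ * A) - - (δ * σ) * B) (sym δ²≡1) ⟩
  δ * δ * (- σ * A) - - (δ * σ) * B  ≡⟨ expand δ σ A B ⟩
  δ * σ * (B - δ * A)                ∎
  where
  open ≡-Reasoning
  expand : ∀ δ σ A B → δ * δ * (- σ * A) - - (δ * σ) * B ≡ δ * σ * (B - δ * A)
  expand = solve 4 (λ δ σ A B → δ :* δ :* (:- σ :* A) :- :- (δ :* σ) :* B := δ :* σ :* (B :- δ :* A)) refl

theorem4p1 : (n d : ℕ) (Δ : Complex n) (κ : Fin n → Fin d) →
    IsBalanced d Δ κ → (S : Subset d) →
    flagH Δ κ S - flagH Δ κ (∁ S)
      ≡ sgn (d ∸ ∣ S ∣) * sumOver (λ F → Δ F ∧ (colours κ F ⊆ᵇ S)) (err d Δ)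
theorem4p1 n d Δ κ ((_ , closed) , _ , proper) S = begin
  flagH Δ κ S - flagH Δ κ (∁ S)
    ≡⟨ cong₂ _-_ (flagH≡sgn*redEuler Δ κ proper S) (flagH≡sgn*redEuler Δ κ proper (∁ S)) ⟩
  sgn (suc ∣ S ∣) * χ K - sgn (suc ∣ ∁ S ∣) * χ (preimage κ (∁ S))
    ≡⟨ cong₂ (λ k L → sgn (suc ∣ S ∣) * χ K - sgn (suc k) * χ L) (∣∁p∣≡n∸∣p∣ S) (preimage-∁ κ S) ⟩
  - sgn ∣ S ∣ * χ K - - u * χ (∁ K)
    ≡⟨ sign-rearrangement (sgn d) (sgn ∣ S ∣) u (χ K) (χ (∁ K)) (sgn-square d) (sgn-∸ d ∣ S ∣ (∣p∣≤n S)) ⟩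
  u * (χ (∁ K) - sgn d * χ K)
    ≡⟨ cong (λ z → u * (z - sgn d * χ K)) (sym (∑-redEuler-link Δ closed K)) ⟩
  u * (sumOver (induced Δ K) (λ F → redEuler (link Δ F)) - sgn d * χ K)
    ≡⟨ cong (u *_) (sym (sumOver-err d Δ (induced Δ K))) ⟩
  u * sumOver (induced Δ K) (err d Δ)
    ≡⟨ cong (u *_) (sumOver-cong (err d Δ) rankSelected≡induced) ⟨
  u * sumOver (λ F → Δ F ∧ (colours κ F ⊆ᵇ S)) (err d Δ)
    ∎
  where
  open ≡-Reasoning
  u = sgn (d ∸ ∣ S ∣)
  K = preimage κ S

  χ : Subset n → ℤ
  χ L = redEuler (induced Δ L)

  rankSelected≡induced : ∀ F → Δ F ∧ (colours κ F ⊆ᵇ S) ≡ induced Δ K F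
  rankSelected≡induced F = cong (Δ F ∧_) (trans (⊆ᵇ≡⊑ (colours κ F) S) (colours⊑≡⊑preimage κ F S))
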